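{- Let $n\geq 3$ and let $\lambda=(\lambda_1,\ldots,\lambda_s)$ be a partition of $n$ with $s\geq 2$ and $\lambda_1>\lambda_2\geq\cdots\geq\lambda_s$; put $m=\lambda_2+\cdots+\lambda_s$. Let $t$ be a standard tableau of shape $\lambda$ with $n$ in the last cell of its first row. Then the polytabloid $\mathbf{e}_t$ is an eigenvector of $J_n$ acting on $M^\lambda$ with eigenvalue $n-m-1$, i.e. $J_n(\mathbf{e}_t)=(n-m-1)\mathbf{e}_t$.
   Context: A tableau of shape $\lambda$ is a bijective filling of the Young diagram of $\lambda$ with $1,\ldots,n$; it is standard if entries increase along rows and down columns. For $\sigma\in\mathrm{Sym}_n$, $\sigma(t)$ replaces each entry $x$ of $t$ by $\sigma(x)$. The tabloid $\{t\}$ is the set of tableaux obtained from $t$ by permuting entries within rows; $M^\lambda$ is the complex vector space with basis the $\lambda$-tabloids, with $\mathrm{Sym}_n$ acting linearly by $\sigma\{t\}=\{\sigma(t)\}$. $C_t$ is the column stabilizer of $t$ and $\mathbf{e}_t=\sum_{c\in C_t}\mathrm{sgn}(c)\{c(t)\}$. $J_n=(1\ n)+(2\ n)+\cdots+(n-1\ n)$ acts on $M^\lambda$ through the $\mathrm{Sym}_n$-action. -}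

module Defs where

open import Data.Nat as ℕ using (ℕ; zero; suc; _∸_; _≤_; _≥_)
open import Data.Nat.Properties as ℕP using ()
open import Data.Fin as Fin using (Fin; toℕ)
open import Data.Fin.Properties as FinP using ()
open import Data.Bool as Bool using (Bool; true; false; _∧_; _∨_; if_then_else_; not)
open import Data.Integer as ℤ using (ℤ; +_; -_)
open import Data.List as List using (List; []; _∷_; _++_; map; concatMap; filterᵇ; allFin; foldr)
open import Data.Bool.ListAction using (all; any)
open import Data.Nat.ListAction using (sum)
open import Data.List.Relation.Unary.All using (All)
open import Data.List.Relation.Unary.Linked using (Linked)
open import Data.Vec as Vec using (Vec)
open import Data.Vec.Properties as VecP using ()
open import Data.Product using (Σ; _×_; _,_; proj₁; proj₂)
open import Relation.Nullary.Decidable using (⌊_⌋)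
open import Relation.Binary.PropositionalEquality using (_≡_)
open import Function.Definitions using (Bijective)
open import Function using (_∘_)

-- Convention: the entries 1,…,n are represented by Fin n = {0,…,n-1};
-- entry k corresponds to the element of Fin n with toℕ = k - 1.

record IsPartition (n : ℕ) (sh : List ℕ) : Set where
  field
    sums     : sum sh ≡ n
    positive : All (λ x → 1 ≤ x) sh
    decr     : Linked _≥_ sh

Cell : List ℕ → Set
Cell sh = Σ (Fin (List.length sh)) (λ i → Fin (List.lookup sh i))

row : ∀ {sh} → Cell sh → Fin (List.length sh)
row = proj₁

col : ∀ {sh} → Cell sh → ℕ
col c = toℕ (proj₂ c)

allCells : (sh : List ℕ) → List (Cell sh)
allCells sh = concatMap (λ i → map (i ,_) (allFin (List.lookup sh i))) (allFin (List.length sh))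

IsTableau : ∀ {sh n} → (Cell sh → Fin n) → Set
IsTableau t = Bijective _≡_ _≡_ t

record IsStandard {sh n} (t : Cell sh → Fin n) : Set where
  field
    tableau : IsTableau {sh} t
    rows    : ∀ (c d : Cell sh) → row {sh} c ≡ row {sh} d → col {sh} c ℕ.< col {sh} d →
              toℕ (t c) ℕ.< toℕ (t d)
    cols    : ∀ (c d : Cell sh) → col {sh} c ≡ col {sh} d → toℕ (row {sh} c) ℕ.< toℕ (row {sh} d) →
              toℕ (t c) ℕ.< toℕ (t d)

-- Tabloids: a tabloid {u} is determined by the set of entries in each row,
-- so it is represented by the vector of its row-sets (subsets of Fin n).

Tabloid : ℕ → ℕ → Set
Tabloid n s = Vec (Vec Bool n) s

_≟T_ : ∀ {n s} (T U : Tabloid n s) → Bool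
T ≟T U = ⌊ VecP.≡-dec (VecP.≡-dec Bool._≟_) T U ⌋

_==_ : ∀ {n} → Fin n → Fin n → Bool
a == b = ⌊ a FinP.≟ b ⌋

tabloid : ∀ {sh n} → (Cell sh → Fin n) → Tabloid n (List.length sh)
tabloid {sh} u = Vec.tabulate λ i → Vec.tabulate λ y →
  any (λ j → u (i , j) == y) (allFin (List.lookup sh i))

image : ∀ {n} → (Fin n → Fin n) → Vec Bool n → Vec Bool n
image {n} σ S = Vec.tabulate λ y → any (λ x → Vec.lookup S x ∧ (σ x == y)) (allFin n)

actTabloid : ∀ {n s} → (Fin n → Fin n) → Tabloid n s → Tabloid n s
actTabloid σ T = Vec.map (image σ) T

allFuns : (m n : ℕ) → List (Fin m → Fin n)
allFuns zero    n = (λ ()) ∷ []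
allFuns (suc m) n = concatMap (λ f → map (λ b → cons b f) (allFin n)) (allFuns m n)
  where
  cons : Fin n → (Fin m → Fin n) → Fin (suc m) → Fin n
  cons b f Fin.zero    = b
  cons b f (Fin.suc x) = f x

isInjective : ∀ {n} → (Fin n → Fin n) → Bool
isInjective {n} f = all (λ x → all (λ y → not (f x == f y) ∨ (x == y)) (allFin n)) (allFin n)

-- Sym_n: all injective (hence bijective) self-maps of Fin n
Sym : (n : ℕ) → List (Fin n → Fin n)
Sym n = filterᵇ isInjective (allFuns n n)

inversions : ∀ {n} → (Fin n → Fin n) → ℕ
inversions {n} σ = List.length
  (filterᵇ (λ p → ⌊ proj₁ p Fin.<? proj₂ p ⌋ ∧ ⌊ σ (proj₂ p) Fin.<? σ (proj₁ p) ⌋)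
           (List.cartesianProduct (allFin n) (allFin n)))

signOf : ℕ → ℤ
signOf zero    = + 1
signOf (suc k) = - signOf k

sgn : ∀ {n} → (Fin n → Fin n) → ℤ
sgn σ = signOf (inversions σ)

stabilizesColumns : ∀ {sh n} → (Cell sh → Fin n) → (Fin n → Fin n) → Bool
stabilizesColumns {sh} t c =
  all (λ d → any (λ d' → ⌊ col {sh} d' ℕ.≟ col {sh} d ⌋ ∧ (t d' == c (t d))) (allCells sh)) (allCells sh)

ColumnStabilizer : ∀ {sh n} → (Cell sh → Fin n) → List (Fin n → Fin n)
ColumnStabilizer {sh} {n} t = filterᵇ (stabilizesColumns {sh} t) (Sym n)

-- M^λ: formal ℤ-linear combinations of tabloids

FormalSum : ℕ → ℕ → Set
FormalSum n s = List (ℤ × Tabloid n s)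

coeff : ∀ {n s} → FormalSum n s → Tabloid n s → ℤ
coeff v T = foldr (λ p acc → (if proj₂ p ≟T T then proj₁ p else + 0) ℤ.+ acc) (+ 0) v

_≈M_ : ∀ {n s} → FormalSum n s → FormalSum n s → Set
v ≈M w = ∀ T → coeff v T ≡ coeff w T

_·M_ : ∀ {n s} → ℤ → FormalSum n s → FormalSum n s
a ·M v = map (λ p → a ℤ.* proj₁ p , proj₂ p) v

actM : ∀ {n s} → (Fin n → Fin n) → FormalSum n s → FormalSum n s
actM σ v = map (λ p → proj₁ p , actTabloid σ (proj₂ p)) v

polytabloid : ∀ {sh n} → (Cell sh → Fin n) → FormalSum n (List.length sh)
polytabloid {sh} t = map (λ c → sgn c , tabloid {sh} (c ∘ t)) (ColumnStabilizer {sh} t)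

transposition : ∀ {n} → Fin n → Fin n → Fin n → Fin n
transposition a b x = if x == a then b else (if x == b then a else x)

-- J_n = (1 n) + (2 n) + … + (n-1 n): sum over a, b with b the entry n
-- (toℕ b = n - 1) and a < b.
Jn : ∀ {n s} → FormalSum n s → FormalSum n s
Jn {n} v = concatMap (λ b → concatMap (λ a →
    if ⌊ toℕ b ℕ.≟ n ∸ 1 ⌋ ∧ ⌊ toℕ a ℕ.<? toℕ b ⌋
    then actM (transposition a b) v else []) (allFin n)) (allFin n)

nInLastCellOfFirstRow : ∀ {sh n} → (Cell sh → Fin n) → Set
nInLastCellOfFirstRow {l₁ ∷ rest} {n} t =
  ∀ (c : Cell (l₁ ∷ rest)) → toℕ (row {l₁ ∷ rest} c) ≡ 0 → suc (col {l₁ ∷ rest} c) ≡ l₁ →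
  toℕ (t c) ≡ n ∸ 1
nInLastCellOfFirstRow {[]} t = Data.Empty.⊥
  where import Data.Empty

-- Let N be the entry n, at the end of the first row of t, and C the column
-- stabilizer of t. As the first row is strictly the longest, N is alone in
-- its column, so every c ∈ C fixes N; substituting a = c x, J_n e_t is the
-- sum of sgn(c) {(c x  N) c t} over c ∈ C and x ≠ N. If x lies in the first
-- row of t, then c x and N share a row of c t, the transposition fixes the
-- tabloid, and the λ₁ - 1 such x give (λ₁ - 1) e_t. If x lies in a lower
-- row, let y be the first-row entry of its column. Then c ↦ c (x y) is an
-- involution of C that flips sgn(c) but not the tabloid of the term for x,
-- since (c y  N) c (x y) = (c x  N) (c y  N) c and (c y  N) fixes {c t}.
-- So these terms cancel, and λ₁ - 1 = n - m - 1.

module Submission where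

open import Defs
open import Data.Bool using (Bool; true; false; T; _∧_; _∨_; not; if_then_else_)
open import Data.Bool.ListAction using (all; any; and; or)
open import Data.Bool.Properties using (T-≡; T-∧; ∧-identityʳ)
open import Data.Empty using (⊥; ⊥-elim)
open import Data.Fin as Fin using (Fin; toℕ)
open import Data.Fin.Patterns using (0F; 1F)
open import Data.Fin.Properties as Finₚ using (toℕ-injective; suc-injective; 0≢1+n)
open import Data.List as List using (List; []; _∷_; _++_; map; concatMap; filterᵇ; allFin; foldr; tabulate)
open import Data.List.Membership.Propositional using (_∈_; lose)
open import Data.List.Membership.Propositional.Properties using (∈-allFin; ∈-concatMap⁺; ∈-map⁺; ∈-filter⁻; ∈-lookup)
open import Data.List.Properties using (map-tabulate; map-∘)
import Data.List.Relation.Unary.All as All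
open import Data.List.Relation.Unary.All.Properties as Allₚ using (all⁺; all⁻)
open import Data.List.Relation.Unary.Any using (here; there; satisfied)
open import Data.List.Relation.Unary.Any.Properties as Anyₚ using (any⁺; any⁻)
open import Data.Nat as ℕ using (ℕ; zero; suc; _∸_)
import Data.Nat.Properties as ℕₚ
open import Data.Product using (∃; _×_; _,_; proj₁; proj₂)
import Data.Vec as Vec
open import Data.Vec.Functional using () renaming (_∷_ to _◂_)
import Data.Vec.Properties as Vecₚ
open import Function using (_∘_; id)
open import Function.Bundles using (Equivalence)
open import Function.Definitions using (Injective)
open import Relation.Binary.Definitions using (tri<; tri≈; tri>)
open import Relation.Binary.PropositionalEquality
open import Relation.Nullary using (yes; no)
open import Relation.Nullary.Decidable using (⌊_⌋; toWitness; fromWitness; T?)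

module Eigenvector where

  open import Data.Integer as ℤ using (ℤ; +_; -_; _+_; _*_)
  open import Data.Integer.Properties
    using (+-identityˡ; +-identityʳ; +-assoc; *-zeroˡ; *-zeroʳ; *-identityˡ; *-comm; *-distribˡ-+;
           neg-distrib-+; neg-distribˡ-*; neg-distribʳ-*; neg-involutive; +-injective)
  open import Data.Integer.Tactic.RingSolver using (solve-∀)

  -- A right fold, so that coeff v X unfolds to ∑ v (λ p → [ proj₂ p ≟T X ]· proj₁ p).
  ∑ : {A : Set} → List A → (A → ℤ) → ℤ
  ∑ xs f = foldr (λ x acc → f x + acc) (+ 0) xs

  [_]·_ : Bool → ℤ → ℤ
  [ b ]· z = if b then z else + 0

  infix 8 [_]·_

  [·]-neg : (b : Bool) (z : ℤ) → [ b ]· (- z) ≡ - [ b ]· z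
  [·]-neg true  z = refl
  [·]-neg false z = refl

  [·]-∧ : (a b : Bool) (z : ℤ) → [ a ∧ b ]· z ≡ [ a ]· [ b ]· z
  [·]-∧ true  b z = refl
  [·]-∧ false b z = refl

  [·]-∨-disjoint : (a b : Bool) → (T a → T b → ⊥) → [ a ∨ b ]· + 1 ≡ [ a ]· + 1 + [ b ]· + 1
  [·]-∨-disjoint true  true  a∧b = ⊥-elim (a∧b _ _)
  [·]-∨-disjoint true  false _   = refl
  [·]-∨-disjoint false true  _   = refl
  [·]-∨-disjoint false false _   = refl

  ≡-neg⇒≡0 : ∀ {a} → a ≡ - a → a ≡ + 0
  ≡-neg⇒≡0 {+ zero}     _  = refl
  ≡-neg⇒≡0 {ℤ.+[1+ n ]} ()
  ≡-neg⇒≡0 {ℤ.-[1+ n ]} ()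

  module _ {A : Set} where

    ∑-cong : (xs : List A) {f g : A → ℤ} → (∀ x → f x ≡ g x) → ∑ xs f ≡ ∑ xs g
    ∑-cong []       f≗g = refl
    ∑-cong (x ∷ xs) f≗g = cong₂ _+_ (f≗g x) (∑-cong xs f≗g)

    ∑-cong-∈ : (xs : List A) {f g : A → ℤ} → (∀ x → x ∈ xs → f x ≡ g x) → ∑ xs f ≡ ∑ xs g
    ∑-cong-∈ []       f≗g = refl
    ∑-cong-∈ (x ∷ xs) f≗g = cong₂ _+_ (f≗g x (here refl)) (∑-cong-∈ xs (λ y y∈xs → f≗g y (there y∈xs)))

    ∑-++ : (xs ys : List A) (f : A → ℤ) → ∑ (xs ++ ys) f ≡ ∑ xs f + ∑ ys f
    ∑-++ []       ys f = sym (+-identityˡ _)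
    ∑-++ (x ∷ xs) ys f = trans (cong (_+_ (f x)) (∑-++ xs ys f)) (sym (+-assoc (f x) _ _))

    ∑-zero : (xs : List A) → ∑ xs (λ _ → + 0) ≡ + 0
    ∑-zero []       = refl
    ∑-zero (x ∷ xs) = trans (+-identityˡ _) (∑-zero xs)

    ∑-+ : (xs : List A) (f g : A → ℤ) → ∑ xs (λ x → f x + g x) ≡ ∑ xs f + ∑ xs g
    ∑-+ []       f g = refl
    ∑-+ (x ∷ xs) f g = trans (cong (_+_ (f x + g x)) (∑-+ xs f g)) (interchange (f x) (g x) (∑ xs f) (∑ xs g))
      where
      interchange : ∀ a b c d → a + b + (c + d) ≡ a + c + (b + d)
      interchange = solve-∀

    ∑-*ˡ : (xs : List A) (k : ℤ) (f : A → ℤ) → ∑ xs (λ x → k * f x) ≡ k * ∑ xs f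
    ∑-*ˡ []       k f = sym (*-zeroʳ k)
    ∑-*ˡ (x ∷ xs) k f = trans (cong (_+_ (k * f x)) (∑-*ˡ xs k f)) (sym (*-distribˡ-+ k (f x) _))

    ∑-*ʳ : (xs : List A) (f : A → ℤ) (k : ℤ) → ∑ xs (λ x → f x * k) ≡ ∑ xs f * k
    ∑-*ʳ xs f k = begin
      ∑ xs (λ x → f x * k) ≡⟨ ∑-cong xs (λ x → *-comm (f x) k) ⟩
      ∑ xs (λ x → k * f x) ≡⟨ ∑-*ˡ xs k f ⟩
      k * ∑ xs f           ≡⟨ *-comm k _ ⟩
      ∑ xs f * k           ∎
      where open ≡-Reasoning

    ∑-neg : (xs : List A) (f : A → ℤ) → ∑ xs (λ x → - f x) ≡ - ∑ xs f
    ∑-neg []       f = refl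
    ∑-neg (x ∷ xs) f = trans (cong (_+_ (- f x)) (∑-neg xs f)) (sym (neg-distrib-+ (f x) _))

    ∑-filterᵇ : (p : A → Bool) (xs : List A) (f : A → ℤ) → ∑ (filterᵇ p xs) f ≡ ∑ xs (λ x → [ p x ]· f x)
    ∑-filterᵇ p []       f = refl
    ∑-filterᵇ p (x ∷ xs) f with p x
    ... | true  = cong (_+_ (f x)) (∑-filterᵇ p xs f)
    ... | false = trans (∑-filterᵇ p xs f) (sym (+-identityˡ _))

    [·]-∑ : (b : Bool) (xs : List A) (f : A → ℤ) → [ b ]· ∑ xs f ≡ ∑ xs (λ x → [ b ]· f x)
    [·]-∑ true  xs f = refl
    [·]-∑ false xs f = sym (∑-zero xs)

  module _ {A B : Set} where

    ∑-map : (g : A → B) (xs : List A) (f : B → ℤ) → ∑ (map g xs) f ≡ ∑ xs (f ∘ g)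
    ∑-map g []       f = refl
    ∑-map g (x ∷ xs) f = cong (_+_ (f (g x))) (∑-map g xs f)

    ∑-concatMap : (g : A → List B) (xs : List A) (f : B → ℤ) → ∑ (concatMap g xs) f ≡ ∑ xs (λ x → ∑ (g x) f)
    ∑-concatMap g []       f = refl
    ∑-concatMap g (x ∷ xs) f = trans (∑-++ (g x) _ f) (cong (_+_ (∑ (g x) f)) (∑-concatMap g xs f))

    ∑-comm : (xs : List A) (ys : List B) (f : A → B → ℤ) →
             ∑ xs (λ x → ∑ ys (f x)) ≡ ∑ ys (λ y → ∑ xs (λ x → f x y))
    ∑-comm []       ys f = sym (∑-zero ys)
    ∑-comm (x ∷ xs) ys f = trans (cong (_+_ (∑ ys (f x))) (∑-comm xs ys f)) (sym (∑-+ ys (f x) _))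

  T-⇔⇒≡ : {a b : Bool} → (T a → T b) → (T b → T a) → a ≡ b
  T-⇔⇒≡ {false} {false} _ _ = refl
  T-⇔⇒≡ {false} {true}  _ g = ⊥-elim (g _)
  T-⇔⇒≡ {true}  {false} f _ = ⊥-elim (f _)
  T-⇔⇒≡ {true}  {true}  _ _ = refl

  module _ {n : ℕ} where

    ==-sound : {a b : Fin n} → T (a == b) → a ≡ b
    ==-sound {a} {b} = toWitness {a? = a Finₚ.≟ b}

    ==-complete : {a b : Fin n} → a ≡ b → T (a == b)
    ==-complete {a} {b} = fromWitness {a? = a Finₚ.≟ b}

    ==-refl : (a : Fin n) → (a == a) ≡ true
    ==-refl a = Equivalence.to T-≡ (==-complete {a} refl)

    ==-≢ : {a b : Fin n} → a ≢ b → (a == b) ≡ false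
    ==-≢ {a} {b} a≢b with a Finₚ.≟ b
    ... | yes a≡b = ⊥-elim (a≢b a≡b)
    ... | no  _   = refl

    ==-comm : (a b : Fin n) → (a == b) ≡ (b == a)
    ==-comm a b = T-⇔⇒≡ (==-complete ∘ sym ∘ ==-sound) (==-complete ∘ sym ∘ ==-sound)

    any-allFin⁺ : (p : Fin n → Bool) (i : Fin n) → T (p i) → T (any p (allFin n))
    any-allFin⁺ p i pi = any⁺ p (Anyₚ.tabulate⁺ i pi)

    any-allFin⁻ : (p : Fin n → Bool) → T (any p (allFin n)) → ∃ λ i → T (p i)
    any-allFin⁻ p h = Anyₚ.tabulate⁻ (any⁻ p (allFin n) h)

    all-allFin⁺ : (p : Fin n → Bool) → (∀ i → T (p i)) → T (all p (allFin n))
    all-allFin⁺ p h = all⁻ p (Allₚ.tabulate⁺ h)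

    all-allFin⁻ : (p : Fin n → Bool) → T (all p (allFin n)) → ∀ i → T (p i)
    all-allFin⁻ p h = Allₚ.tabulate⁻ (all⁺ p (allFin n) h)

    map-suc-allFin : map Fin.suc (allFin n) ≡ tabulate Fin.suc
    map-suc-allFin = map-tabulate id Fin.suc

  module _ {n : ℕ} where

    ∑-allFin-suc : (f : Fin (suc n) → ℤ) → ∑ (allFin (suc n)) f ≡ f 0F + ∑ (allFin n) (f ∘ Fin.suc)
    ∑-allFin-suc f = cong (_+_ (f 0F)) (trans (cong (λ xs → ∑ xs f) (sym map-suc-allFin)) (∑-map Fin.suc (allFin n) f))

    all-allFin-suc : (p : Fin (suc n) → Bool) → all p (allFin (suc n)) ≡ p 0F ∧ all (p ∘ Fin.suc) (allFin n)
    all-allFin-suc p = cong (λ xs → p 0F ∧ and xs)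
      (trans (cong (map p) (sym map-suc-allFin)) (sym (map-∘ (allFin n))))

    any-allFin-suc : (p : Fin (suc n) → Bool) → any p (allFin (suc n)) ≡ p 0F ∨ any (p ∘ Fin.suc) (allFin n)
    any-allFin-suc p = cong (λ xs → p 0F ∨ or xs)
      (trans (cong (map p) (sym map-suc-allFin)) (sym (map-∘ (allFin n))))

  ∑-allFin-support : ∀ {n} (v : Fin n) (f : Fin n → ℤ) → (∀ x → x ≢ v → f x ≡ + 0) → ∑ (allFin n) f ≡ f v
  ∑-allFin-support {suc n} 0F f off = begin
    ∑ (allFin (suc n)) f               ≡⟨ ∑-allFin-suc f ⟩
    f 0F + ∑ (allFin n) (f ∘ Fin.suc)  ≡⟨ cong (_+_ (f 0F)) rest-vanishes ⟩
    f 0F + + 0                         ≡⟨ +-identityʳ _ ⟩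
    f 0F                               ∎
    where
    open ≡-Reasoning
    rest-vanishes : ∑ (allFin n) (f ∘ Fin.suc) ≡ + 0
    rest-vanishes = trans (∑-cong (allFin n) (λ x → off (Fin.suc x) λ ())) (∑-zero (allFin n))
  ∑-allFin-support {suc n} (Fin.suc v) f off = begin
    ∑ (allFin (suc n)) f               ≡⟨ ∑-allFin-suc f ⟩
    f 0F + ∑ (allFin n) (f ∘ Fin.suc)  ≡⟨ cong₂ _+_ (off 0F λ ()) (∑-allFin-support v (f ∘ Fin.suc) off-suc) ⟩
    + 0 + f (Fin.suc v)                ≡⟨ +-identityˡ _ ⟩
    f (Fin.suc v)                      ∎
    where
    open ≡-Reasoning
    off-suc : ∀ x → x ≢ v → f (Fin.suc x) ≡ + 0
    off-suc x x≢v = off (Fin.suc x) (x≢v ∘ suc-injective)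

  ∑-allFin-δ : ∀ {n} (v : Fin n) (f : Fin n → ℤ) → ∑ (allFin n) (λ x → [ x == v ]· f x) ≡ f v
  ∑-allFin-δ v f = trans (∑-allFin-support v _ (λ x x≢v → cong (λ b → [ b ]· f x) (==-≢ x≢v)))
                         (cong (λ b → [ b ]· f v) (==-refl v))

  ∑-allFin-δ′ : ∀ {n} (v : Fin n) (f : Fin n → ℤ) → ∑ (allFin n) (λ x → [ v == x ]· f x) ≡ f v
  ∑-allFin-δ′ {n} v f = trans (∑-cong (allFin n) (λ x → cong (λ b → [ b ]· f x) (==-comm v x))) (∑-allFin-δ v f)

  injective⇒surjective : ∀ {n} {c : Fin n → Fin n} → Injective _≡_ _≡_ c → ∀ a → ∃ λ x → c x ≡ a
  injective⇒surjective {suc n} {c} c-inj a with Finₚ.any? (λ x → c x Finₚ.≟ a)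
  ... | yes hit = hit
  ... | no miss = ⊥-elim (ℕₚ.<-irrefl refl (Finₚ.injective⇒≤ punched-inj))
    where
    punched : Fin (suc n) → Fin n
    punched x = Fin.punchOut {i = a} (λ a≡cx → miss (x , sym a≡cx))
    punched-inj : Injective _≡_ _≡_ punched
    punched-inj {x} {y} eq = c-inj (Finₚ.punchOut-injective {i = a} _ _ eq)

  ∑-allFin-injective : ∀ {n} {c : Fin n → Fin n} → Injective _≡_ _≡_ c → (f : Fin n → ℤ) →
                       ∑ (allFin n) (f ∘ c) ≡ ∑ (allFin n) f
  ∑-allFin-injective {n} {c} c-inj f = begin
    ∑ (allFin n) (f ∘ c)                                        ≡⟨ ∑-cong (allFin n) (λ x → sym (∑-allFin-δ′ (c x) f)) ⟩
    ∑ (allFin n) (λ x → ∑ (allFin n) (λ a → [ c x == a ]· f a)) ≡⟨ ∑-comm (allFin n) (allFin n) (λ x a → [ c x == a ]· f a) ⟩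
    ∑ (allFin n) (λ a → ∑ (allFin n) (λ x → [ c x == a ]· f a)) ≡⟨ ∑-cong (allFin n) fibre ⟩
    ∑ (allFin n) f                                              ∎
    where
    open ≡-Reasoning
    fibre : ∀ a → ∑ (allFin n) (λ x → [ c x == a ]· f a) ≡ f a
    fibre a with injective⇒surjective c-inj a
    ... | x₀ , refl = trans (∑-allFin-support x₀ _ (λ x x≢x₀ → cong (λ b → [ b ]· f (c x₀)) (==-≢ (x≢x₀ ∘ c-inj))))
                            (cong (λ b → [ b ]· f (c x₀)) (==-refl (c x₀)))

  ∑-image-indicator : ∀ {k n} (g : Fin k → Fin n) → Injective _≡_ _≡_ g →
                      ∑ (allFin n) (λ x → [ any (λ j → g j == x) (allFin k) ]· + 1) ≡ + k
  ∑-image-indicator {zero}  {n} g g-inj = ∑-zero (allFin n)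
  ∑-image-indicator {suc k} {n} g g-inj = begin
    ∑ (allFin n) (λ x → [ any (λ j → g j == x) (allFin (suc k)) ]· + 1)
      ≡⟨ ∑-cong (allFin n) (λ x → trans (cong (λ b → [ b ]· + 1) (any-allFin-suc (λ j → g j == x)))
                                         ([·]-∨-disjoint _ _ (disjoint x))) ⟩
    ∑ (allFin n) (λ x → [ g 0F == x ]· + 1 + [ later x ]· + 1)
      ≡⟨ ∑-+ (allFin n) (λ x → [ g 0F == x ]· + 1) (λ x → [ later x ]· + 1) ⟩
    ∑ (allFin n) (λ x → [ g 0F == x ]· + 1) + ∑ (allFin n) (λ x → [ later x ]· + 1)
      ≡⟨ cong₂ _+_ (∑-allFin-δ′ (g 0F) _) (∑-image-indicator (g ∘ Fin.suc) (suc-injective ∘ g-inj)) ⟩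
    + suc k ∎
    where
    open ≡-Reasoning
    later : Fin n → Bool
    later x = any (λ j → g (Fin.suc j) == x) (allFin k)
    disjoint : ∀ x → T (g 0F == x) → T (later x) → ⊥
    disjoint x first again with any-allFin⁻ (λ j → g (Fin.suc j) == x) again
    ... | j , gj≡x with g-inj (trans (==-sound first) (sym (==-sound gj≡x)))
    ... | ()

  -- Lacking function extensionality, reindexing a sum over allFuns needs a summand that respects _≗_.
  Extensional : {A B C : Set} → ((A → B) → C) → Set
  Extensional G = ∀ {f g} → f ≗ g → G f ≡ G g

  module _ {m n : ℕ} where

    _≗ᵇ_ : (Fin m → Fin n) → (Fin m → Fin n) → Bool
    g ≗ᵇ h = all (λ x → g x == h x) (allFin m)

    ≗ᵇ-sound : {g h : Fin m → Fin n} → T (g ≗ᵇ h) → g ≗ h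
    ≗ᵇ-sound {g} {h} g≗ᵇh x = ==-sound (all-allFin⁻ (λ x → g x == h x) g≗ᵇh x)

    ≗ᵇ-complete : {g h : Fin m → Fin n} → g ≗ h → T (g ≗ᵇ h)
    ≗ᵇ-complete {g} {h} g≗h = all-allFin⁺ (λ x → g x == h x) (λ x → ==-complete (g≗h x))

    ≗ᵇ-congˡ : {g g′ : Fin m → Fin n} (h : Fin m → Fin n) → g ≗ g′ → (g ≗ᵇ h) ≡ (g′ ≗ᵇ h)
    ≗ᵇ-congˡ h g≗g′ = T-⇔⇒≡ (λ e → ≗ᵇ-complete (λ x → trans (sym (g≗g′ x)) (≗ᵇ-sound e x)))
                            (λ e → ≗ᵇ-complete (λ x → trans (g≗g′ x) (≗ᵇ-sound e x)))

  ∑-allFuns-suc : ∀ {m n} (G : (Fin (suc m) → Fin n) → ℤ) → Extensional G →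
                  ∑ (allFuns (suc m) n) G ≡ ∑ (allFuns m n) (λ f → ∑ (allFin n) (λ b → G (b ◂ f)))
  ∑-allFuns-suc {m} {n} G G-ext = trans (∑-concatMap _ (allFuns m n) G) (∑-cong (allFuns m n) λ f →
    trans (∑-map _ (allFin n) G) (∑-cong (allFin n) λ b → G-ext λ { 0F → refl ; (Fin.suc x) → refl }))

  ∑-allFuns-≗ᵇ : ∀ m n (h : Fin m → Fin n) (z : ℤ) → ∑ (allFuns m n) (λ g → [ g ≗ᵇ h ]· z) ≡ z
  ∑-allFuns-≗ᵇ zero    n h z = +-identityʳ z
  ∑-allFuns-≗ᵇ (suc m) n h z = begin
    ∑ (allFuns (suc m) n) (λ g → [ g ≗ᵇ h ]· z)
      ≡⟨ ∑-allFuns-suc (λ g → [ g ≗ᵇ h ]· z) (λ g≗g′ → cong (λ b → [ b ]· z) (≗ᵇ-congˡ h g≗g′)) ⟩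
    ∑ (allFuns m n) (λ f → ∑ (allFin n) (λ b → [ (b ◂ f) ≗ᵇ h ]· z))
      ≡⟨ ∑-cong (allFuns m n) (λ f → ∑-cong (allFin n) λ b →
           trans (cong (λ c → [ c ]· z) (all-allFin-suc (λ x → (b ◂ f) x == h x)))
                 ([·]-∧ (b == h 0F) (f ≗ᵇ (h ∘ Fin.suc)) z)) ⟩
    ∑ (allFuns m n) (λ f → ∑ (allFin n) (λ b → [ b == h 0F ]· [ f ≗ᵇ (h ∘ Fin.suc) ]· z))
      ≡⟨ ∑-cong (allFuns m n) (λ f → ∑-allFin-δ (h 0F) _) ⟩
    ∑ (allFuns m n) (λ f → [ f ≗ᵇ (h ∘ Fin.suc) ]· z)
      ≡⟨ ∑-allFuns-≗ᵇ m n (h ∘ Fin.suc) z ⟩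
    z ∎
    where open ≡-Reasoning

  ∑-allFuns-δ : ∀ {m n} (h : Fin m → Fin n) (G : (Fin m → Fin n) → ℤ) → Extensional G →
                ∑ (allFuns m n) (λ g → [ g ≗ᵇ h ]· G g) ≡ G h
  ∑-allFuns-δ {m} {n} h G G-ext =
    trans (∑-cong (allFuns m n) (λ g → indicator g (g ≗ᵇ h) refl)) (∑-allFuns-≗ᵇ m n h (G h))
    where
    indicator : ∀ g b → (g ≗ᵇ h) ≡ b → [ b ]· G g ≡ [ b ]· G h
    indicator g true  e = G-ext (≗ᵇ-sound (subst T (sym e) _))
    indicator g false e = refl

  ∑-allFuns-∘ : ∀ {m n} {ρ ρ⁻¹ : Fin m → Fin m} → (∀ x → ρ (ρ⁻¹ x) ≡ x) → (∀ x → ρ⁻¹ (ρ x) ≡ x) →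
                (G : (Fin m → Fin n) → ℤ) → Extensional G →
                ∑ (allFuns m n) (λ f → G (f ∘ ρ)) ≡ ∑ (allFuns m n) G
  ∑-allFuns-∘ {m} {n} {ρ} {ρ⁻¹} ρρ⁻¹ ρ⁻¹ρ G G-ext = begin
    ∑ (allFuns m n) (λ f → G (f ∘ ρ))
      ≡⟨ ∑-cong (allFuns m n) (λ f → sym (∑-allFuns-δ (f ∘ ρ) G G-ext)) ⟩
    ∑ (allFuns m n) (λ f → ∑ (allFuns m n) (λ g → [ g ≗ᵇ (f ∘ ρ) ]· G g))
      ≡⟨ ∑-comm (allFuns m n) (allFuns m n) (λ f g → [ g ≗ᵇ (f ∘ ρ) ]· G g) ⟩
    ∑ (allFuns m n) (λ g → ∑ (allFuns m n) (λ f → [ g ≗ᵇ (f ∘ ρ) ]· G g))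
      ≡⟨ ∑-cong (allFuns m n) (λ g → ∑-cong (allFuns m n) λ f → cong (λ b → [ b ]· G g) (transpose f g)) ⟩
    ∑ (allFuns m n) (λ g → ∑ (allFuns m n) (λ f → [ f ≗ᵇ (g ∘ ρ⁻¹) ]· G g))
      ≡⟨ ∑-cong (allFuns m n) (λ g → ∑-allFuns-≗ᵇ m n (g ∘ ρ⁻¹) (G g)) ⟩
    ∑ (allFuns m n) G ∎
    where
    open ≡-Reasoning
    transpose : ∀ f g → (g ≗ᵇ (f ∘ ρ)) ≡ (f ≗ᵇ (g ∘ ρ⁻¹))
    transpose f g = T-⇔⇒≡
      (λ e → ≗ᵇ-complete λ x → trans (cong f (sym (ρρ⁻¹ x))) (sym (≗ᵇ-sound e (ρ⁻¹ x))))
      (λ e → ≗ᵇ-complete λ x → trans (cong g (sym (ρ⁻¹ρ x))) (sym (≗ᵇ-sound e (ρ x))))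

  τ : ∀ {n} → Fin n → Fin n → Fin n → Fin n
  τ = transposition

  module _ {n : ℕ} where

    τ-left : (a b : Fin n) → τ a b a ≡ b
    τ-left a b rewrite ==-refl a = refl

    τ-right : (a b : Fin n) → τ a b b ≡ a
    τ-right a b with b == a in b=a
    ... | true  = ==-sound (Equivalence.from T-≡ b=a)
    ... | false rewrite ==-refl b = refl

    τ-other : (a b : Fin n) {z : Fin n} → z ≢ a → z ≢ b → τ a b z ≡ z
    τ-other a b z≢a z≢b rewrite ==-≢ z≢a | ==-≢ z≢b = refl

    data Position (a b z : Fin n) : Set where
      at-left   : z ≡ a → Position a b z
      at-right  : z ≡ b → z ≢ a → Position a b z
      elsewhere : z ≢ a → z ≢ b → Position a b z

    position : (a b z : Fin n) → Position a b z
    position a b z with z Finₚ.≟ a | z Finₚ.≟ b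
    ... | yes z≡a | _       = at-left z≡a
    ... | no z≢a  | yes z≡b = at-right z≡b z≢a
    ... | no z≢a  | no z≢b  = elsewhere z≢a z≢b

    τ-involutive : (a b z : Fin n) → τ a b (τ a b z) ≡ z
    τ-involutive a b z with position a b z
    ... | at-left refl      rewrite τ-left a b  = τ-right a b
    ... | at-right refl _   rewrite τ-right a b = τ-left a b
    ... | elsewhere z≢a z≢b rewrite τ-other a b z≢a z≢b = τ-other a b z≢a z≢b

    τ-injective : (a b : Fin n) → Injective _≡_ _≡_ (τ a b)
    τ-injective a b {x} {y} eq = trans (sym (τ-involutive a b x)) (trans (cong (τ a b) eq) (τ-involutive a b y))

    τ-comm : (a b z : Fin n) → τ a b z ≡ τ b a z
    τ-comm a b z with position a b z
    ... | at-left refl      = trans (τ-left a b) (sym (τ-right b a))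
    ... | at-right refl _   = trans (τ-right a b) (sym (τ-left b a))
    ... | elsewhere z≢a z≢b = trans (τ-other a b z≢a z≢b) (sym (τ-other b a z≢b z≢a))

  τ-conjugate : ∀ {m n} (f : Fin m → Fin n) → Injective _≡_ _≡_ f →
                (a b z : Fin m) → f (τ a b z) ≡ τ (f a) (f b) (f z)
  τ-conjugate f f-inj a b z with position a b z
  ... | at-left refl      = trans (cong f (τ-left a b)) (sym (τ-left (f a) (f b)))
  ... | at-right refl _   = trans (cong f (τ-right a b)) (sym (τ-right (f a) (f b)))
  ... | elsewhere z≢a z≢b = trans (cong f (τ-other a b z≢a z≢b)) (sym (τ-other (f a) (f b) (z≢a ∘ f-inj) (z≢b ∘ f-inj)))

  τ-suc : ∀ {n} (a b z : Fin n) → τ (Fin.suc a) (Fin.suc b) (Fin.suc z) ≡ Fin.suc (τ a b z)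
  τ-suc a b z = sym (τ-conjugate Fin.suc suc-injective a b z)

  τ-suc-zero : ∀ {n} (a b : Fin n) → τ (Fin.suc a) (Fin.suc b) 0F ≡ 0F
  τ-suc-zero a b = τ-other (Fin.suc a) (Fin.suc b) (λ ()) (λ ())

  τ-braid : ∀ {n} {a b c : Fin n} → a ≢ b → a ≢ c → (w : Fin n) → τ b c (τ a b w) ≡ τ a c (τ b c w)
  τ-braid {a = a} {b} {c} a≢b a≢c w = begin
    τ b c (τ a b w)                   ≡⟨ τ-conjugate (τ b c) (τ-injective b c) a b w ⟩
    τ (τ b c a) (τ b c b) (τ b c w)   ≡⟨ cong₂ (λ x y → τ x y (τ b c w)) (τ-other b c a≢b a≢c) (τ-left b c) ⟩
    τ a c (τ b c w)                   ∎
    where open ≡-Reasoning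

  -- Inversions and the sign

  module _ {A : Set} where

    count : (A → Bool) → List A → ℕ
    count p xs = List.length (filterᵇ p xs)

    count-∑ : (p : A → Bool) (xs : List A) → + count p xs ≡ ∑ xs (λ x → [ p x ]· + 1)
    count-∑ p []       = refl
    count-∑ p (x ∷ xs) with p x
    ... | true  = cong (_+_ (+ 1)) (count-∑ p xs)
    ... | false = trans (count-∑ p xs) (sym (+-identityˡ _))

    count-cong : (xs : List A) {p q : A → Bool} → (∀ x → p x ≡ q x) → count p xs ≡ count q xs
    count-cong xs {p} {q} p≗q = +-injective (trans (count-∑ p xs)
      (trans (∑-cong xs (λ x → cong (λ b → [ b ]· + 1) (p≗q x))) (sym (count-∑ q xs))))

  ∑-cartesianProduct : ∀ {A B : Set} (xs : List A) (ys : List B) (f : A × B → ℤ) →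
                       ∑ (List.cartesianProduct xs ys) f ≡ ∑ xs (λ x → ∑ ys (λ y → f (x , y)))
  ∑-cartesianProduct []       ys f = refl
  ∑-cartesianProduct (x ∷ xs) ys f =
    trans (∑-++ (map (x ,_) ys) _ f) (cong₂ _+_ (∑-map (x ,_) ys f) (∑-cartesianProduct xs ys f))

  _<ᵇ_ : ∀ {n} → Fin n → Fin n → Bool
  a <ᵇ b = ⌊ a Fin.<? b ⌋

  <ᵇ-suc : ∀ {n} (a b : Fin n) → (Fin.suc a <ᵇ Fin.suc b) ≡ (a <ᵇ b)
  <ᵇ-suc a b with a Fin.<? b | Fin.suc a Fin.<? Fin.suc b
  ... | yes _   | yes _     = refl
  ... | no  _   | no  _     = refl
  ... | yes a<b | no  sa≮sb = ⊥-elim (sa≮sb (ℕ.s≤s a<b))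
  ... | no  a≮b | yes sa<sb = ⊥-elim (a≮b (ℕₚ.≤-pred sa<sb))

  <ᵇ-asym : ∀ {n} {a b : Fin n} → a ≢ b → (a <ᵇ b) ≡ not (b <ᵇ a)
  <ᵇ-asym {a = a} {b} a≢b with a Fin.<? b | b Fin.<? a
  ... | yes a<b | yes b<a = ⊥-elim (ℕₚ.<-asym a<b b<a)
  ... | yes _   | no  _   = refl
  ... | no  _   | yes _   = refl
  ... | no  a≮b | no  b≮a = ⊥-elim (a≢b (toℕ-injective (ℕₚ.≤-antisym (ℕₚ.≮⇒≥ b≮a) (ℕₚ.≮⇒≥ a≮b))))

  <ᵇ-max : ∀ {n} {N : Fin n} → toℕ N ≡ n ∸ 1 → (a : Fin n) → (a <ᵇ N) ≡ not (a == N)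
  <ᵇ-max {suc n} {N} N-max a with a Finₚ.≟ N | a Fin.<? N
  ... | yes refl | yes a<a  = ⊥-elim (ℕₚ.<-irrefl refl a<a)
  ... | yes refl | no  _    = refl
  ... | no  _    | yes _    = refl
  ... | no  a≢N  | no  a≮N  =
    ⊥-elim (a≮N (ℕₚ.≤∧≢⇒< (subst (toℕ a ℕ.≤_) (sym N-max) (Finₚ.toℕ≤pred[n]′ a)) (a≢N ∘ toℕ-injective)))

  module _ {m n : ℕ} where

    inverted : (Fin m → Fin n) → Fin m × Fin m → Bool
    inverted g pq = (proj₁ pq <ᵇ proj₂ pq) ∧ (g (proj₂ pq) <ᵇ g (proj₁ pq))

    -- inversions, generalised to maps Fin m → Fin n so that g ∘ suc is covered; sgn σ is definitionally sign σ.
    #inversions : (Fin m → Fin n) → ℕ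
    #inversions g = count (inverted g) (List.cartesianProduct (allFin m) (allFin m))

    sign : (Fin m → Fin n) → ℤ
    sign g = signOf (#inversions g)

    sign-cong : {f g : Fin m → Fin n} → f ≗ g → sign f ≡ sign g
    sign-cong f≗g = cong signOf (count-cong (List.cartesianProduct (allFin m) (allFin m))
      (λ pq → cong₂ (λ a b → (proj₁ pq <ᵇ proj₂ pq) ∧ (a <ᵇ b)) (f≗g (proj₂ pq)) (f≗g (proj₁ pq))))

  bit : Bool → ℕ
  bit b = if b then 1 else 0

  count-allFin-suc : ∀ {m} (p : Fin (suc m) → Bool) → count p (allFin (suc m)) ≡ bit (p 0F) ℕ.+ count (p ∘ Fin.suc) (allFin m)
  count-allFin-suc {m} p = +-injective (begin
    + count p (allFin (suc m))                                   ≡⟨ count-∑ p (allFin (suc m)) ⟩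
    ∑ (allFin (suc m)) (λ x → [ p x ]· + 1)                      ≡⟨ ∑-allFin-suc (λ x → [ p x ]· + 1) ⟩
    [ p 0F ]· + 1 + ∑ (allFin m) (λ x → [ p (Fin.suc x) ]· + 1)  ≡⟨ cong₂ _+_ (bit-∑ (p 0F)) (sym (count-∑ (p ∘ Fin.suc) (allFin m))) ⟩
    + bit (p 0F) + + count (p ∘ Fin.suc) (allFin m)              ∎)
    where
    open ≡-Reasoning
    bit-∑ : ∀ b → [ b ]· + 1 ≡ + bit b
    bit-∑ true  = refl
    bit-∑ false = refl

  count-allFin-injective : ∀ {m} {c : Fin m → Fin m} → Injective _≡_ _≡_ c → (p : Fin m → Bool) →
                           count (p ∘ c) (allFin m) ≡ count p (allFin m)
  count-allFin-injective {m} {c} c-inj p = +-injective (begin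
    + count (p ∘ c) (allFin m)                     ≡⟨ count-∑ (p ∘ c) (allFin m) ⟩
    ∑ (allFin m) (λ x → [ p (c x) ]· + 1)          ≡⟨ ∑-allFin-injective c-inj (λ x → [ p x ]· + 1) ⟩
    ∑ (allFin m) (λ x → [ p x ]· + 1)              ≡⟨ count-∑ p (allFin m) ⟨
    + count p (allFin m)                           ∎)
    where open ≡-Reasoning

  belowHead : ∀ {m n} → (Fin (suc m) → Fin n) → ℕ
  belowHead {m} g = count (λ q → g (Fin.suc q) <ᵇ g 0F) (allFin m)

  #inversions-suc : ∀ {m n} (g : Fin (suc m) → Fin n) → #inversions g ≡ belowHead g ℕ.+ #inversions (g ∘ Fin.suc)
  #inversions-suc {m} {n} g = +-injective (begin
    + #inversions g
      ≡⟨ as-double-sum g ⟩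
    ∑ (allFin (suc m)) (λ p → ∑ (allFin (suc m)) (F g p))
      ≡⟨ ∑-allFin-suc (λ p → ∑ (allFin (suc m)) (F g p)) ⟩
    ∑ (allFin (suc m)) (F g 0F) + ∑ (allFin m) (λ p → ∑ (allFin (suc m)) (F g (Fin.suc p)))
      ≡⟨ cong₂ _+_ (drop-diagonal 0F) (∑-cong (allFin m) (drop-diagonal ∘ Fin.suc)) ⟩
    ∑ (allFin m) (λ q → [ g (Fin.suc q) <ᵇ g 0F ]· + 1) + ∑ (allFin m) (λ p → ∑ (allFin m) (λ q → F g (Fin.suc p) (Fin.suc q)))
      ≡⟨ cong₂ _+_ (sym (count-∑ (λ q → g (Fin.suc q) <ᵇ g 0F) (allFin m)))
                   (∑-cong (allFin m) λ p → ∑-cong (allFin m) λ q →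
                      cong (λ b → [ b ∧ (g (Fin.suc q) <ᵇ g (Fin.suc p)) ]· + 1) (<ᵇ-suc p q)) ⟩
    + belowHead g + ∑ (allFin m) (λ p → ∑ (allFin m) (F (g ∘ Fin.suc) p))
      ≡⟨ cong (_+_ (+ belowHead g)) (sym (as-double-sum (g ∘ Fin.suc))) ⟩
    + belowHead g + + #inversions (g ∘ Fin.suc) ∎)
    where
    open ≡-Reasoning
    F : ∀ {k} (h : Fin k → Fin n) → Fin k → Fin k → ℤ
    F h p q = [ inverted h (p , q) ]· + 1
    as-double-sum : ∀ {k} (h : Fin k → Fin n) → + #inversions h ≡ ∑ (allFin k) (λ p → ∑ (allFin k) (F h p))
    as-double-sum {k} h = trans (count-∑ (inverted h) (List.cartesianProduct (allFin k) (allFin k)))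
                                (∑-cartesianProduct (allFin k) (allFin k) (λ pq → [ inverted h pq ]· + 1))
    drop-diagonal : ∀ p → ∑ (allFin (suc m)) (F g p) ≡ ∑ (allFin m) (F g p ∘ Fin.suc)
    drop-diagonal p = trans (∑-allFin-suc (F g p)) (+-identityˡ (∑ (allFin m) (F g p ∘ Fin.suc)))

  signOf-+ : ∀ a b → signOf (a ℕ.+ b) ≡ signOf a * signOf b
  signOf-+ zero    b = sym (*-identityˡ (signOf b))
  signOf-+ (suc a) b = trans (cong -_ (signOf-+ a b)) (neg-distribˡ-* (signOf a) (signOf b))

  sign-suc : ∀ {m n} (g : Fin (suc m) → Fin n) → sign g ≡ signOf (belowHead g) * sign (g ∘ Fin.suc)
  sign-suc g = trans (cong signOf (#inversions-suc g)) (signOf-+ (belowHead g) _)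

  sign-∘-τ-suc : ∀ {m n} (g : Fin (suc m) → Fin n) (x y : Fin m) →
                 sign (g ∘ Fin.suc ∘ τ x y) ≡ - sign (g ∘ Fin.suc) →
                 sign (g ∘ τ (Fin.suc x) (Fin.suc y)) ≡ - sign g
  sign-∘-τ-suc {m} g x y flips = begin
    sign (g ∘ τ (Fin.suc x) (Fin.suc y))
      ≡⟨ sign-suc (g ∘ τ (Fin.suc x) (Fin.suc y)) ⟩
    signOf (belowHead (g ∘ τ (Fin.suc x) (Fin.suc y))) * sign (g ∘ τ (Fin.suc x) (Fin.suc y) ∘ Fin.suc)
      ≡⟨ cong₂ _*_ (cong signOf head-count) (trans (sign-cong (λ q → cong g (τ-suc x y q))) flips) ⟩
    signOf (belowHead g) * - sign (g ∘ Fin.suc)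
      ≡⟨ neg-distribʳ-* (signOf (belowHead g)) _ ⟨
    - (signOf (belowHead g) * sign (g ∘ Fin.suc))
      ≡⟨ cong -_ (sign-suc g) ⟨
    - sign g ∎
    where
    open ≡-Reasoning
    head-count : belowHead (g ∘ τ (Fin.suc x) (Fin.suc y)) ≡ belowHead g
    head-count = trans (count-cong (allFin m) (λ q → cong₂ _<ᵇ_ (cong g (τ-suc x y q)) (cong g (τ-suc-zero x y))))
                       (count-allFin-injective (τ-injective x y) (λ q → g (Fin.suc q) <ᵇ g 0F))

  signOf-bit-not : ∀ b → signOf (bit (not b)) ≡ - signOf (bit b)
  signOf-bit-not true  = refl
  signOf-bit-not false = refl

  sign-expand₂ : ∀ {m n} (f : Fin (suc (suc m)) → Fin n) →
    sign f ≡ signOf (bit (f 1F <ᵇ f 0F) ℕ.+ count (λ q → f (Fin.suc (Fin.suc q)) <ᵇ f 0F) (allFin m))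
             * (signOf (count (λ q → f (Fin.suc (Fin.suc q)) <ᵇ f 1F) (allFin m)) * sign (f ∘ Fin.suc ∘ Fin.suc))
  sign-expand₂ f = trans (sign-suc f)
    (cong₂ _*_ (cong signOf (count-allFin-suc (λ q → f (Fin.suc q) <ᵇ f 0F))) (sign-suc (f ∘ Fin.suc)))

  sign-∘-τ₀₁ : ∀ {m n} (g : Fin (suc (suc m)) → Fin n) → g 0F ≢ g 1F → sign (g ∘ τ 0F 1F) ≡ - sign g
  -- Swapping the first two values flips their comparison and exchanges the counts P and Q.
  sign-∘-τ₀₁ {m} g g₀≢g₁ = begin
    sign (g ∘ τ 0F 1F)
      ≡⟨ sign-expand₂ (g ∘ τ 0F 1F) ⟩
    signOf (bit (g₀ <ᵇ g₁) ℕ.+ Q) * (signOf P * R)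
      ≡⟨ cong (λ s → s * (signOf P * R)) (trans (signOf-+ (bit (g₀ <ᵇ g₁)) Q)
           (cong (_* signOf Q) (trans (cong (signOf ∘ bit) (<ᵇ-asym g₀≢g₁)) (signOf-bit-not (g₁ <ᵇ g₀))))) ⟩
    - signOf (bit (g₁ <ᵇ g₀)) * signOf Q * (signOf P * R)
      ≡⟨ rearrange (signOf (bit (g₁ <ᵇ g₀))) (signOf Q) (signOf P) R ⟩
    - (signOf (bit (g₁ <ᵇ g₀)) * signOf P * (signOf Q * R))
      ≡⟨ cong (λ s → - (s * (signOf Q * R))) (signOf-+ (bit (g₁ <ᵇ g₀)) P) ⟨
    - (signOf (bit (g₁ <ᵇ g₀) ℕ.+ P) * (signOf Q * R))
      ≡⟨ cong -_ (sign-expand₂ g) ⟨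
    - sign g ∎
    where
    open ≡-Reasoning
    g₀ = g 0F
    g₁ = g 1F
    P = count (λ q → g (Fin.suc (Fin.suc q)) <ᵇ g₀) (allFin m)
    Q = count (λ q → g (Fin.suc (Fin.suc q)) <ᵇ g₁) (allFin m)
    R = sign (g ∘ Fin.suc ∘ Fin.suc)
    rearrange : ∀ b q p r → - b * q * (p * r) ≡ - (b * p * (q * r))
    rearrange = solve-∀

  τ₀-decompose : ∀ {m} (y : Fin (suc m)) →
                 τ 0F (Fin.suc (Fin.suc y)) ≗ τ 0F 1F ∘ τ 1F (Fin.suc (Fin.suc y)) ∘ τ 0F 1F
  τ₀-decompose y z = begin
    τ 0F Y z                          ≡⟨ cong (τ 0F Y) (τ-involutive 0F 1F z) ⟨
    τ 0F Y (τ₀₁ (τ₀₁ z))              ≡⟨ cong₂ (λ a b → τ a b (τ₀₁ (τ₀₁ z))) (τ-right 0F 1F) (τ-other 0F 1F (λ ()) (λ ())) ⟨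
    τ (τ₀₁ 1F) (τ₀₁ Y) (τ₀₁ (τ₀₁ z))  ≡⟨ τ-conjugate τ₀₁ (τ-injective 0F 1F) 1F Y (τ₀₁ z) ⟨
    τ₀₁ (τ 1F Y (τ₀₁ z))              ∎
    where
    open ≡-Reasoning
    Y = Fin.suc (Fin.suc y)
    τ₀₁ = τ 0F 1F

  sign-∘-τ : ∀ {m n} (g : Fin m → Fin n) → Injective _≡_ _≡_ g → (x y : Fin m) → toℕ x ℕ.< toℕ y →
             sign (g ∘ τ x y) ≡ - sign g
  sign-∘-τ g g-inj (Fin.suc x) (Fin.suc y) x<y =
    sign-∘-τ-suc g x y (sign-∘-τ (g ∘ Fin.suc) (suc-injective ∘ g-inj) x y (ℕₚ.≤-pred x<y))
  sign-∘-τ g g-inj 0F (Fin.suc 0F) _ = sign-∘-τ₀₁ g (λ eq → 0≢1+n (g-inj eq))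
  sign-∘-τ {suc (suc (suc m))} g g-inj 0F (Fin.suc (Fin.suc y)) _ = begin
    sign (g ∘ τ 0F Y)        ≡⟨ sign-cong (cong g ∘ τ₀-decompose y) ⟩
    sign (h ∘ τ 1F Y ∘ τ₀₁)  ≡⟨ sign-∘-τ₀₁ (h ∘ τ 1F Y) (λ eq → 0≢1+n (τ-injective 1F Y {0F} {1F} (h-inj eq))) ⟩
    - sign (h ∘ τ 1F Y)      ≡⟨ cong -_ (sign-∘-τ-suc h 0F (Fin.suc y)
                                   (sign-∘-τ (h ∘ Fin.suc) (suc-injective ∘ h-inj) 0F (Fin.suc y) (ℕ.s≤s ℕ.z≤n))) ⟩
    - - sign h               ≡⟨ neg-involutive (sign h) ⟩
    sign h                   ≡⟨ sign-∘-τ₀₁ g (0≢1+n ∘ g-inj) ⟩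
    - sign g                 ∎
    where
    open ≡-Reasoning
    Y = Fin.suc (Fin.suc y)
    τ₀₁ = τ 0F 1F
    h = g ∘ τ₀₁
    h-inj : Injective _≡_ _≡_ h
    h-inj = τ-injective 0F 1F ∘ g-inj

  sign-∘-τ-≢ : ∀ {m n} (g : Fin m → Fin n) → Injective _≡_ _≡_ g → {x y : Fin m} → x ≢ y →
               sign (g ∘ τ x y) ≡ - sign g
  sign-∘-τ-≢ g g-inj {x} {y} x≢y with ℕₚ.<-cmp (toℕ x) (toℕ y)
  ... | tri< x<y _ _ = sign-∘-τ g g-inj x y x<y
  ... | tri≈ _ x≡y _ = ⊥-elim (x≢y (toℕ-injective x≡y))
  ... | tri> _ _ y<x = trans (sign-cong (cong g ∘ τ-comm x y)) (sign-∘-τ g g-inj y x y<x)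

  -- Tabloids

  module _ {sh : List ℕ} {n : ℕ} where

    inRow : (Cell sh → Fin n) → Fin (List.length sh) → Fin n → Bool
    inRow u i y = any (λ j → u (i , j) == y) (allFin (List.lookup sh i))

    inRow-intro : (u : Cell sh → Fin n) (i : Fin (List.length sh)) (j : Fin (List.lookup sh i)) → T (inRow u i (u (i , j)))
    inRow-intro u i j = any-allFin⁺ (λ j′ → u (i , j′) == u (i , j)) j (==-complete refl)

    inRow-elim : (u : Cell sh → Fin n) (i : Fin (List.length sh)) {y : Fin n} → T (inRow u i y) →
                 ∃ λ j → u (i , j) ≡ y
    inRow-elim u i {y} h with any-allFin⁻ (λ j → u (i , j) == y) h
    ... | j , uij=y = j , ==-sound uij=y

    tabloid-≡ : {u v : Cell sh → Fin n} →
                (∀ i j → ∃ λ j′ → u (i , j) ≡ v (i , j′)) → (∀ i j → ∃ λ j′ → v (i , j) ≡ u (i , j′)) →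
                tabloid {sh} u ≡ tabloid {sh} v
    tabloid-≡ {u} {v} u⊆v v⊆u = Vecₚ.tabulate-cong λ i → Vecₚ.tabulate-cong λ y →
      T-⇔⇒≡ (included u v u⊆v i) (included v u v⊆u i)
      where
      included : ∀ u v → (∀ i j → ∃ λ j′ → u (i , j) ≡ v (i , j′)) → ∀ i {y} → T (inRow u i y) → T (inRow v i y)
      included u v u⊆v i h with inRow-elim u i h
      ... | j , refl with u⊆v i j
      ...   | j′ , uij≡vij′ = subst (T ∘ inRow v i) (sym uij≡vij′) (inRow-intro v i j′)

    tabloid-cong : {u v : Cell sh → Fin n} → u ≗ v → tabloid {sh} u ≡ tabloid {sh} v
    tabloid-cong u≗v = tabloid-≡ (λ i j → j , u≗v (i , j)) (λ i j → j , sym (u≗v (i , j)))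

    actTabloid-tabloid : (σ : Fin n → Fin n) (u : Cell sh → Fin n) → actTabloid σ (tabloid {sh} u) ≡ tabloid {sh} (σ ∘ u)
    actTabloid-tabloid σ u = trans (sym (Vecₚ.tabulate-∘ (image σ) rowSet))
      (Vecₚ.tabulate-cong λ i → Vecₚ.tabulate-cong λ y → T-⇔⇒≡ (forward i y) (backward i y))
      where
      rowSet : Fin (List.length sh) → Vec.Vec Bool n
      rowSet i = Vec.tabulate (inRow u i)
      forward : ∀ i y → T (any (λ x → Vec.lookup (rowSet i) x ∧ (σ x == y)) (allFin n)) → T (inRow (σ ∘ u) i y)
      forward i y h with any-allFin⁻ (λ x → Vec.lookup (rowSet i) x ∧ (σ x == y)) h
      ... | x , x∈row∧σx=y with Equivalence.to T-∧ x∈row∧σx=y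
      ...   | x∈row , σx=y with inRow-elim u i (subst T (Vecₚ.lookup∘tabulate (inRow u i) x) x∈row)
      ...     | j , refl = subst (T ∘ inRow (σ ∘ u) i) (==-sound σx=y) (inRow-intro (σ ∘ u) i j)
      backward : ∀ i y → T (inRow (σ ∘ u) i y) → T (any (λ x → Vec.lookup (rowSet i) x ∧ (σ x == y)) (allFin n))
      backward i y h with inRow-elim (σ ∘ u) i h
      ... | j , σuij≡y = any-allFin⁺ (λ x → Vec.lookup (rowSet i) x ∧ (σ x == y)) (u (i , j))
        (Equivalence.from T-∧ (subst T (sym (Vecₚ.lookup∘tabulate (inRow u i) (u (i , j)))) (inRow-intro u i j) , ==-complete σuij≡y))

    tabloid-∘-τ-sameRow : (u : Cell sh → Fin n) → Injective _≡_ _≡_ u →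
                          (i : Fin (List.length sh)) (j₁ j₂ : Fin (List.lookup sh i)) →
                          tabloid {sh} (τ (u (i , j₁)) (u (i , j₂)) ∘ u) ≡ tabloid {sh} u
    tabloid-∘-τ-sameRow u u-inj i j₁ j₂ = tabloid-≡ moved (λ i′ j → let j′ , p = moved i′ j in
      j′ , trans (sym (τ-involutive a b (u (i′ , j)))) (cong (τ a b) p))
      where
      a = u (i , j₁)
      b = u (i , j₂)
      moved : ∀ i′ j → ∃ λ j′ → τ a b (u (i′ , j)) ≡ u (i′ , j′)
      moved i′ j with position a b (u (i′ , j))
      ... | at-left uij≡a with u-inj uij≡a
      ...   | refl = j₂ , trans (cong (τ a b) uij≡a) (τ-left a b)
      moved i′ j | at-right uij≡b _ with u-inj uij≡b
      ...   | refl = j₁ , trans (cong (τ a b) uij≡b) (τ-right a b)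
      moved i′ j | elsewhere ≢a ≢b = j , τ-other a b ≢a ≢b

  -- Column stabilizers

  module _ {n : ℕ} where

    isInjective-sound : (f : Fin n → Fin n) → T (isInjective f) → Injective _≡_ _≡_ f
    isInjective-sound f h {x} {y} fx≡fy =
      ==-sound (subst (λ b → T (not b ∨ (x == y))) (Equivalence.to T-≡ (==-complete fx≡fy))
        (all-allFin⁻ (λ y → not (f x == f y) ∨ (x == y)) (all-allFin⁻ _ h x) y))

    isInjective-complete : (f : Fin n → Fin n) → Injective _≡_ _≡_ f → T (isInjective f)
    isInjective-complete f f-inj = all-allFin⁺ _ λ x → all-allFin⁺ _ λ y → checked x y
      where
      checked : ∀ x y → T (not (f x == f y) ∨ (x == y))
      checked x y with f x == f y in fx=fy
      ... | true  = ==-complete (f-inj (==-sound (Equivalence.from T-≡ fx=fy)))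
      ... | false = _

    isInjective-cong : {f g : Fin n → Fin n} → f ≗ g → isInjective f ≡ isInjective g
    isInjective-cong {f} {g} f≗g = T-⇔⇒≡
      (λ h → isInjective-complete g λ eq → isInjective-sound f h (trans (f≗g _) (trans eq (sym (f≗g _)))))
      (λ h → isInjective-complete f λ eq → isInjective-sound g h (trans (sym (f≗g _)) (trans eq (f≗g _))))

  ∈-allCells : (sh : List ℕ) (d : Cell sh) → d ∈ allCells sh
  ∈-allCells sh (i , j) =
    ∈-concatMap⁺ (λ i → map (i ,_) (allFin (List.lookup sh i))) (lose (∈-allFin i) (∈-map⁺ (i ,_) (∈-allFin j)))

  module _ {sh : List ℕ} {n : ℕ} (t : Cell sh → Fin n) where

    PreservesColumns : (Fin n → Fin n) → Set
    PreservesColumns c = ∀ d → ∃ λ d′ → col {sh} d′ ≡ col {sh} d × t d′ ≡ c (t d)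

    private
      witnesses : (Fin n → Fin n) → Cell sh → Cell sh → Bool
      witnesses c d d′ = ⌊ col {sh} d′ ℕ.≟ col {sh} d ⌋ ∧ (t d′ == c (t d))

    stabilizesColumns-sound : (c : Fin n → Fin n) → T (stabilizesColumns {sh} t c) → PreservesColumns c
    stabilizesColumns-sound c h d
      with satisfied (any⁻ (witnesses c d) (allCells sh)
                       (All.lookup (all⁺ (λ d → any (witnesses c d) (allCells sh)) (allCells sh) h) (∈-allCells sh d)))
    ... | d′ , found with Equivalence.to T-∧ found
    ...   | same-col , same-entry = d′ , toWitness same-col , ==-sound same-entry

    stabilizesColumns-complete : (c : Fin n → Fin n) → PreservesColumns c → T (stabilizesColumns {sh} t c)
    stabilizesColumns-complete c preserves = all⁻ (λ d → any (witnesses c d) (allCells sh)) {allCells sh} (All.tabulate λ {d} _ →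
      let d′ , same-col , same-entry = preserves d in
      any⁺ (witnesses c d) (lose (∈-allCells sh d′) (Equivalence.from T-∧ (fromWitness same-col , ==-complete same-entry))))

    PreservesColumns-∘ : (f g : Fin n → Fin n) → PreservesColumns f → PreservesColumns g → PreservesColumns (f ∘ g)
    PreservesColumns-∘ f g preserves-f preserves-g d =
      let d₁ , col₁ , entry₁ = preserves-g d
          d₂ , col₂ , entry₂ = preserves-f d₁
      in d₂ , trans col₂ col₁ , trans entry₂ (cong f entry₁)

    τ-preserves-columns : Injective _≡_ _≡_ t → {d₁ d₂ : Cell sh} → col {sh} d₁ ≡ col {sh} d₂ →
                          PreservesColumns (τ (t d₁) (t d₂))
    τ-preserves-columns t-inj {d₁} {d₂} same-col d with position (t d₁) (t d₂) (t d)
    ... | at-left td≡td₁ with t-inj td≡td₁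
    ...   | refl = d₂ , sym same-col , sym (τ-left (t d₁) (t d₂))
    τ-preserves-columns t-inj {d₁} {d₂} same-col d | at-right td≡td₂ _ with t-inj td≡td₂
    ...   | refl = d₁ , same-col , sym (τ-right (t d₁) (t d₂))
    τ-preserves-columns t-inj {d₁} {d₂} same-col d | elsewhere ≢td₁ ≢td₂ =
      d , refl , sym (τ-other (t d₁) (t d₂) ≢td₁ ≢td₂)

    stabilizesColumns-cong : {f g : Fin n → Fin n} → f ≗ g → stabilizesColumns {sh} t f ≡ stabilizesColumns {sh} t g
    stabilizesColumns-cong {f} {g} f≗g = T-⇔⇒≡
      (λ h → stabilizesColumns-complete g λ d → let d′ , c , e = stabilizesColumns-sound f h d in d′ , c , trans e (f≗g (t d)))
      (λ h → stabilizesColumns-complete f λ d → let d′ , c , e = stabilizesColumns-sound g h d in d′ , c , trans e (sym (f≗g (t d))))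

    ∈-ColumnStabilizer⁻ : {c : Fin n → Fin n} → c ∈ ColumnStabilizer {sh} t → Injective _≡_ _≡_ c × PreservesColumns c
    ∈-ColumnStabilizer⁻ {c} c∈C =
      let c∈Sym , stable = ∈-filter⁻ (T? ∘ stabilizesColumns {sh} t) {xs = Sym n} c∈C
          _ , injective = ∈-filter⁻ (T? ∘ isInjective) {xs = allFuns n n} c∈Sym
      in isInjective-sound c injective , stabilizesColumns-sound c stable

    ∑-ColumnStabilizer : (G : (Fin n → Fin n) → ℤ) →
      ∑ (ColumnStabilizer {sh} t) G ≡ ∑ (allFuns n n) (λ f → [ isInjective f ∧ stabilizesColumns {sh} t f ]· G f)
    ∑-ColumnStabilizer G = begin
      ∑ (ColumnStabilizer {sh} t) G
        ≡⟨ ∑-filterᵇ (stabilizesColumns {sh} t) (Sym n) G ⟩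
      ∑ (Sym n) (λ f → [ stabilizesColumns {sh} t f ]· G f)
        ≡⟨ ∑-filterᵇ isInjective (allFuns n n) _ ⟩
      ∑ (allFuns n n) (λ f → [ isInjective f ]· [ stabilizesColumns {sh} t f ]· G f)
        ≡⟨ ∑-cong (allFuns n n) (λ f → sym ([·]-∧ (isInjective f) _ (G f))) ⟩
      ∑ (allFuns n n) (λ f → [ isInjective f ∧ stabilizesColumns {sh} t f ]· G f) ∎
      where open ≡-Reasoning

    ∑-ColumnStabilizer-∘ : {ρ : Fin n → Fin n} → (∀ x → ρ (ρ x) ≡ x) → PreservesColumns ρ →
                           (G : (Fin n → Fin n) → ℤ) → Extensional G →
                           ∑ (ColumnStabilizer {sh} t) (λ c → G (c ∘ ρ)) ≡ ∑ (ColumnStabilizer {sh} t) G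
    ∑-ColumnStabilizer-∘ {ρ} ρρ ρ-stable G G-ext = begin
      ∑ (ColumnStabilizer {sh} t) (λ c → G (c ∘ ρ))
        ≡⟨ ∑-ColumnStabilizer (λ c → G (c ∘ ρ)) ⟩
      ∑ (allFuns n n) (λ f → [ member f ]· G (f ∘ ρ))
        ≡⟨ ∑-cong (allFuns n n) (λ f → cong (λ b → [ b ]· G (f ∘ ρ)) (member-∘ρ f)) ⟨
      ∑ (allFuns n n) (λ f → [ member (f ∘ ρ) ]· G (f ∘ ρ))
        ≡⟨ ∑-allFuns-∘ ρρ ρρ (λ f → [ member f ]· G f) member-ext ⟩
      ∑ (allFuns n n) (λ f → [ member f ]· G f)
        ≡⟨ ∑-ColumnStabilizer G ⟨
      ∑ (ColumnStabilizer {sh} t) G ∎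
      where
      open ≡-Reasoning
      member : (Fin n → Fin n) → Bool
      member f = isInjective f ∧ stabilizesColumns {sh} t f
      ρ-inj : Injective _≡_ _≡_ ρ
      ρ-inj {x} {y} eq = trans (sym (ρρ x)) (trans (cong ρ eq) (ρρ y))
      member-ext : Extensional (λ f → [ member f ]· G f)
      member-ext f≗g = cong₂ [_]·_ (cong₂ _∧_ (isInjective-cong f≗g) (stabilizesColumns-cong f≗g)) (G-ext f≗g)
      f∘ρ∘ρ≗f : ∀ f → f ∘ ρ ∘ ρ ≗ f
      f∘ρ∘ρ≗f f x = cong f (ρρ x)
      injective-∘ρ : ∀ f → isInjective (f ∘ ρ) ≡ isInjective f
      injective-∘ρ f = T-⇔⇒≡
        (λ h → subst T (isInjective-cong (f∘ρ∘ρ≗f f))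
                 (isInjective-complete (f ∘ ρ ∘ ρ) (ρ-inj ∘ isInjective-sound (f ∘ ρ) h)))
        (λ h → isInjective-complete (f ∘ ρ) (ρ-inj ∘ isInjective-sound f h))
      stable-∘ρ : ∀ f → stabilizesColumns {sh} t (f ∘ ρ) ≡ stabilizesColumns {sh} t f
      stable-∘ρ f = T-⇔⇒≡
        (λ h → subst T (stabilizesColumns-cong (f∘ρ∘ρ≗f f))
                 (stabilizesColumns-complete (f ∘ ρ ∘ ρ)
                   (PreservesColumns-∘ (f ∘ ρ) ρ (stabilizesColumns-sound (f ∘ ρ) h) ρ-stable)))
        (λ h → stabilizesColumns-complete (f ∘ ρ) (PreservesColumns-∘ f ρ (stabilizesColumns-sound f h) ρ-stable))
      member-∘ρ : ∀ f → member (f ∘ ρ) ≡ member f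
      member-∘ρ f = cong₂ _∧_ (injective-∘ρ f) (stable-∘ρ f)

    ∑-ColumnStabilizer-vanishes : {ρ : Fin n → Fin n} → (∀ x → ρ (ρ x) ≡ x) → PreservesColumns ρ →
      (G : (Fin n → Fin n) → ℤ) → Extensional G → (∀ c → c ∈ ColumnStabilizer {sh} t → G (c ∘ ρ) ≡ - G c) →
      ∑ (ColumnStabilizer {sh} t) G ≡ + 0
    ∑-ColumnStabilizer-vanishes {ρ} ρρ ρ-stable G G-ext odd = ≡-neg⇒≡0 (begin
      ∑ C G                    ≡⟨ ∑-ColumnStabilizer-∘ ρρ ρ-stable G G-ext ⟨
      ∑ C (λ c → G (c ∘ ρ))    ≡⟨ ∑-cong-∈ C odd ⟩
      ∑ C (λ c → - G c)        ≡⟨ ∑-neg C G ⟩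
      - ∑ C G                  ∎)
      where
      open ≡-Reasoning
      C = ColumnStabilizer {sh} t

  module _ {n s : ℕ} (X : Tabloid n s) where

    coeff-·M : (a : ℤ) (v : FormalSum n s) → coeff (a ·M v) X ≡ a * coeff v X
    coeff-·M a []      = sym (*-zeroʳ a)
    coeff-·M a (p ∷ v) = trans (cong₂ _+_ (scaled (proj₂ p ≟T X)) (coeff-·M a v)) (sym (*-distribˡ-+ a _ (coeff v X)))
      where
      scaled : ∀ b → [ b ]· (a * proj₁ p) ≡ a * [ b ]· proj₁ p
      scaled true  = refl
      scaled false = sym (*-zeroʳ a)

    coeff-Jn : (v : FormalSum n s) (N : Fin n) → toℕ N ≡ n ∸ 1 →
               coeff (Jn v) X ≡ ∑ (allFin n) (λ a → [ a <ᵇ N ]· coeff (actM (τ a N) v) X)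
    coeff-Jn v N N-max = begin
      coeff (Jn v) X
        ≡⟨ ∑-concatMap (λ b → concatMap (summand b) (allFin n)) (allFin n) weight ⟩
      ∑ (allFin n) (λ b → ∑ (concatMap (summand b) (allFin n)) weight)
        ≡⟨ ∑-cong (allFin n) (λ b → trans (∑-concatMap (summand b) (allFin n) weight) (∑-cong (allFin n) (coeff-summand b))) ⟩
      ∑ (allFin n) (λ b → ∑ (allFin n) (λ a → [ isLast b ∧ (a <ᵇ b) ]· coeff (actM (τ a b) v) X))
        ≡⟨ ∑-allFin-support N _ (λ b b≢N → trans (∑-cong (allFin n) (λ a →
             cong (λ c → [ c ∧ (a <ᵇ b) ]· coeff (actM (τ a b) v) X) (not-last b≢N))) (∑-zero (allFin n))) ⟩
      ∑ (allFin n) (λ a → [ isLast N ∧ (a <ᵇ N) ]· coeff (actM (τ a N) v) X)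
        ≡⟨ ∑-cong (allFin n) (λ a → cong (λ c → [ c ∧ (a <ᵇ N) ]· coeff (actM (τ a N) v) X) N-last) ⟩
      ∑ (allFin n) (λ a → [ a <ᵇ N ]· coeff (actM (τ a N) v) X) ∎
      where
      open ≡-Reasoning
      weight : ℤ × Tabloid n s → ℤ
      weight p = [ proj₂ p ≟T X ]· proj₁ p
      isLast : Fin n → Bool
      isLast b = ⌊ toℕ b ℕ.≟ n ∸ 1 ⌋
      summand : Fin n → Fin n → FormalSum n s
      summand b a = if isLast b ∧ (a <ᵇ b) then actM (τ a b) v else []
      coeff-summand : ∀ b a → coeff (summand b a) X ≡ [ isLast b ∧ (a <ᵇ b) ]· coeff (actM (τ a b) v) X
      coeff-summand b a with isLast b ∧ (a <ᵇ b)
      ... | true  = refl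
      ... | false = refl
      not-last : ∀ {b} → b ≢ N → isLast b ≡ false
      not-last {b} b≢N with toℕ b ℕ.≟ n ∸ 1
      ... | yes b-max = ⊥-elim (b≢N (toℕ-injective (trans b-max (sym N-max))))
      ... | no  _     = refl
      N-last : isLast N ≡ true
      N-last with toℕ N ℕ.≟ n ∸ 1
      ... | yes _    = refl
      ... | no  ¬max = ⊥-elim (¬max N-max)

  module _ {sh : List ℕ} {n : ℕ} (t : Cell sh → Fin n) (X : Tabloid n (List.length sh)) where

    private
      weight : ℤ × Tabloid n (List.length sh) → ℤ
      weight p = [ proj₂ p ≟T X ]· proj₁ p

    coeff-actM-polytabloid : (σ : Fin n → Fin n) →
      coeff (actM σ (polytabloid {sh} t)) X ≡ ∑ (ColumnStabilizer {sh} t) (λ c → [ tabloid {sh} (σ ∘ c ∘ t) ≟T X ]· sgn c)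
    coeff-actM-polytabloid σ =
      trans (∑-map (λ p → proj₁ p , actTabloid σ (proj₂ p)) (polytabloid {sh} t) weight)
      (trans (∑-map (λ c → sgn c , tabloid {sh} (c ∘ t)) (ColumnStabilizer {sh} t)
                    (λ p → weight (proj₁ p , actTabloid σ (proj₂ p))))
             (∑-cong (ColumnStabilizer {sh} t) (λ c → cong (λ Y → [ Y ≟T X ]· sgn c) (actTabloid-tabloid {sh} σ (c ∘ t)))))

    coeff-polytabloid : coeff (polytabloid {sh} t) X ≡ ∑ (ColumnStabilizer {sh} t) (λ c → [ tabloid {sh} (c ∘ t) ≟T X ]· sgn c)
    coeff-polytabloid = ∑-map (λ c → sgn c , tabloid {sh} (c ∘ t)) (ColumnStabilizer {sh} t) weight

  -- The eigenvector

  module _ {k n : ℕ} {rows : List ℕ} (t : Cell (suc k ∷ rows) → Fin n) (t-bij : IsTableau {suc k ∷ rows} t)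
           (rows≤k : All.All (ℕ._≤ k) rows) (t-last : toℕ (t (0F , Fin.fromℕ k)) ≡ n ∸ 1) where

    private
      sh : List ℕ
      sh = suc k ∷ rows

    N : Fin n
    N = t (0F , Fin.fromℕ k)

    t-inj : Injective _≡_ _≡_ t
    t-inj = proj₁ t-bij

    lower-col<k : (i : Fin (List.length rows)) (j : Fin (List.lookup rows i)) → toℕ j ℕ.< k
    lower-col<k i j = ℕₚ.<-≤-trans (Finₚ.toℕ<n j) (All.lookup rows≤k (∈-lookup i))

    inFirstRow : Fin n → Bool
    inFirstRow = inRow {sh} t 0F

    C : List (Fin n → Fin n)
    C = ColumnStabilizer {sh} t

    fixes-N : {c : Fin n → Fin n} → c ∈ C → c N ≡ N
    fixes-N c∈C with proj₂ (∈-ColumnStabilizer⁻ {sh} t c∈C) (0F , Fin.fromℕ k)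
    ... | (0F  , j) , same-col , tj≡cN = trans (sym tj≡cN) (cong (λ j → t (0F , j)) (toℕ-injective same-col))
    ... | (Fin.suc i , j) , same-col , _     = ⊥-elim (ℕₚ.<-irrefl (trans same-col (Finₚ.toℕ-fromℕ k)) (lower-col<k i j))

    N-inFirstRow : inFirstRow N ≡ true
    N-inFirstRow = Equivalence.to T-≡ (inRow-intro {sh} t 0F (Fin.fromℕ k))

    outside-firstRow-≢N : ∀ {x} → inFirstRow x ≡ false → x ≢ N
    outside-firstRow-≢N x∉ refl with trans (sym x∉) N-inFirstRow
    ... | ()

    firstRow-count : ∑ (allFin n) (λ x → [ inFirstRow x ∧ not (x == N) ]· + 1) ≡ + k
    firstRow-count = begin
      ∑ (allFin n) (λ x → [ inFirstRow x ∧ not (x == N) ]· + 1)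
        ≡⟨ ∑-cong (allFin n) split ⟩
      ∑ (allFin n) (λ x → [ inFirstRow x ]· + 1 + - [ x == N ]· + 1)
        ≡⟨ ∑-+ (allFin n) (λ x → [ inFirstRow x ]· + 1) (λ x → - [ x == N ]· + 1) ⟩
      ∑ (allFin n) (λ x → [ inFirstRow x ]· + 1) + ∑ (allFin n) (λ x → - [ x == N ]· + 1)
        ≡⟨ cong₂ _+_ (∑-image-indicator (λ j → t (0F , j)) (first-row-inj ∘ t-inj))
                     (trans (∑-neg (allFin n) (λ x → [ x == N ]· + 1)) (cong -_ (∑-allFin-δ N (λ _ → + 1)))) ⟩
      + suc k + - + 1 ∎
      where
      open ≡-Reasoning
      first-row-inj : {j j′ : Fin (suc k)} → _≡_ {A = Cell sh} (0F , j) (0F , j′) → j ≡ j′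
      first-row-inj refl = refl
      split : ∀ x → [ inFirstRow x ∧ not (x == N) ]· + 1 ≡ [ inFirstRow x ]· + 1 + - [ x == N ]· + 1
      split x with x Finₚ.≟ N
      ... | yes refl rewrite N-inFirstRow = refl
      ... | no  _    = trans (cong (λ b → [ b ]· + 1) (∧-identityʳ (inFirstRow x))) (sym (+-identityʳ _))

    t-surj : ∀ y → ∃ λ d → t d ≡ y
    t-surj y = let d , hit = proj₂ t-bij y in d , hit refl

    column-stabilizer-injective : {c : Fin n → Fin n} → c ∈ C → Injective _≡_ _≡_ c
    column-stabilizer-injective c∈C = proj₁ (∈-ColumnStabilizer⁻ {sh} t c∈C)

    tabloid-τ-firstRow : {c : Fin n → Fin n} → c ∈ C → (j : Fin (suc k)) →
                         tabloid {sh} (τ (c (t (0F , j))) N ∘ c ∘ t) ≡ tabloid {sh} (c ∘ t)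
    tabloid-τ-firstRow {c} c∈C j =
      subst (λ M → tabloid {sh} (τ (c (t (0F , j))) M ∘ c ∘ t) ≡ tabloid {sh} (c ∘ t)) (fixes-N c∈C)
            (tabloid-∘-τ-sameRow {sh} (c ∘ t) (λ eq → t-inj (column-stabilizer-injective c∈C eq)) 0F j (Fin.fromℕ k))

    module _ (X : Tabloid n (suc (List.length rows))) where

      term : (Fin n → Fin n) → (Fin n → Fin n) → ℤ
      term σ c = [ tabloid {sh} (σ ∘ c ∘ t) ≟T X ]· sgn c

      row-split : {c : Fin n → Fin n} → c ∈ C →
        ∑ (allFin n) (λ a → [ a <ᵇ N ]· term (τ a N) c) ≡
        + k * term id c + ∑ (allFin n) (λ x → [ not (inFirstRow x) ]· term (τ (c x) N) c)
      row-split {c} c∈C = begin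
        ∑ (allFin n) (λ a → [ a <ᵇ N ]· term (τ a N) c)
          ≡⟨ ∑-cong (allFin n) (λ a → cong (λ b → [ b ]· term (τ a N) c) (<ᵇ-max t-last a)) ⟩
        ∑ (allFin n) (λ a → [ not (a == N) ]· term (τ a N) c)
          ≡⟨ ∑-allFin-injective c-inj (λ a → [ not (a == N) ]· term (τ a N) c) ⟨
        ∑ (allFin n) (λ x → [ not (c x == N) ]· term (τ (c x) N) c)
          ≡⟨ ∑-cong (allFin n) (λ x → trans (cong (λ b → [ not b ]· term (τ (c x) N) c) (c-respects-N x)) (split x)) ⟩
        ∑ (allFin n) (λ x → first x * term id c + later x)
          ≡⟨ ∑-+ (allFin n) (λ x → first x * term id c) later ⟩
        ∑ (allFin n) (λ x → first x * term id c) + ∑ (allFin n) later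
          ≡⟨ cong (_+ ∑ (allFin n) later) (trans (∑-*ʳ (allFin n) first (term id c)) (cong (_* term id c) firstRow-count)) ⟩
        + k * term id c + ∑ (allFin n) later ∎
        where
        open ≡-Reasoning
        c-inj = column-stabilizer-injective c∈C
        first : Fin n → ℤ
        first x = [ inFirstRow x ∧ not (x == N) ]· + 1
        later : Fin n → ℤ
        later x = [ not (inFirstRow x) ]· term (τ (c x) N) c
        c-respects-N : ∀ x → (c x == N) ≡ (x == N)
        c-respects-N x = T-⇔⇒≡ (λ h → ==-complete (c-inj (trans (==-sound h) (sym (fixes-N c∈C)))))
                               (λ h → ==-complete (trans (cong c (==-sound h)) (fixes-N c∈C)))
        split : ∀ x → [ not (x == N) ]· term (τ (c x) N) c ≡ first x * term id c + later x
        split x with inFirstRow x in x-first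
        ... | true with inRow-elim {sh} t 0F (Equivalence.from T-≡ x-first)
        ...   | j , refl = first-row (not (x == N)) (cong (λ Y → [ Y ≟T X ]· sgn c) (tabloid-τ-firstRow c∈C j))
          where
          first-row : ∀ b {z z₀} → z ≡ z₀ → [ b ]· z ≡ [ b ]· + 1 * z₀ + + 0
          first-row true  {z₀ = z₀} z≡z₀ = trans z≡z₀ (sym (trans (+-identityʳ _) (*-identityˡ z₀)))
          first-row false {z₀ = z₀} _    = sym (trans (+-identityʳ _) (*-zeroˡ z₀))
        split x | false rewrite ==-≢ (outside-firstRow-≢N x-first) =
          sym (trans (cong (_+ term (τ (c x) N) c) (*-zeroˡ (term id c))) (+-identityˡ _))

      term-τ-ext : (x : Fin n) → Extensional (λ c → term (τ (c x) N) c)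
      term-τ-ext x {f} {g} f≗g = cong₂ (λ Y s → [ Y ≟T X ]· s)
        (tabloid-cong {sh} (λ d → cong₂ (λ a b → τ a N b) (f≗g x) (f≗g (t d))))
        (sign-cong f≗g)

      term-∘-τ : {c : Fin n → Fin n} → c ∈ C → {x y : Fin n} → inFirstRow x ≡ false → (j : Fin (suc k)) → t (0F , j) ≡ y →
                 term (τ (c (τ x y x)) N) (c ∘ τ x y) ≡ - term (τ (c x) N) c
      term-∘-τ {c} c∈C {x} {y} x∉ j refl =
        trans (cong₂ (λ Y s → [ Y ≟T X ]· s) swapped (sign-∘-τ-≢ c c-inj x≢y)) ([·]-neg _ (sgn c))
        where
        open ≡-Reasoning
        c-inj = column-stabilizer-injective c∈C
        x≢y : x ≢ y
        x≢y refl with trans (sym x∉) (Equivalence.to T-≡ (inRow-intro {sh} t 0F j))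
        ... | ()
        cx≢N : c x ≢ N
        cx≢N eq = outside-firstRow-≢N x∉ (c-inj (trans eq (sym (fixes-N c∈C))))
        pointwise : ∀ d → τ (c (τ x y x)) N (c (τ x y (t d))) ≡ τ (c x) N (τ (c y) N (c (t d)))
        pointwise d = trans (cong₂ (λ a b → τ a N b) (cong c (τ-left x y)) (τ-conjugate c c-inj x y (t d)))
                            (τ-braid (λ eq → x≢y (c-inj eq)) cx≢N (c (t d)))
        swapped : tabloid {sh} (τ (c (τ x y x)) N ∘ c ∘ τ x y ∘ t) ≡ tabloid {sh} (τ (c x) N ∘ c ∘ t)
        swapped = begin
          tabloid {sh} (τ (c (τ x y x)) N ∘ c ∘ τ x y ∘ t)          ≡⟨ tabloid-cong {sh} pointwise ⟩
          tabloid {sh} (τ (c x) N ∘ τ (c y) N ∘ c ∘ t)              ≡⟨ actTabloid-tabloid {sh} (τ (c x) N) (τ (c y) N ∘ c ∘ t) ⟨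
          actTabloid (τ (c x) N) (tabloid {sh} (τ (c y) N ∘ c ∘ t)) ≡⟨ cong (actTabloid (τ (c x) N)) (tabloid-τ-firstRow c∈C j) ⟩
          actTabloid (τ (c x) N) (tabloid {sh} (c ∘ t))             ≡⟨ actTabloid-tabloid {sh} (τ (c x) N) (c ∘ t) ⟩
          tabloid {sh} (τ (c x) N ∘ c ∘ t)                          ∎

      lower-vanishes : (x : Fin n) → inFirstRow x ≡ false → ∑ C (λ c → term (τ (c x) N) c) ≡ + 0
      lower-vanishes x x∉ with t-surj x
      ... | (0F , j) , refl with trans (sym x∉) (Equivalence.to T-≡ (inRow-intro {sh} t 0F j))
      ...   | ()
      lower-vanishes x x∉ | (Fin.suc i , j) , refl =
        ∑-ColumnStabilizer-vanishes {sh} t (τ-involutive x y)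
          (τ-preserves-columns {sh} t t-inj (sym (Finₚ.toℕ-fromℕ< _)))
          (λ c → term (τ (c x) N) c) (term-τ-ext x) (λ c c∈C → term-∘-τ c∈C x∉ j′ refl)
        where
        j′ : Fin (suc k)
        j′ = Fin.fromℕ< (ℕₚ.m<n⇒m<1+n (lower-col<k i j))
        y : Fin n
        y = t (0F , j′)

      lower-terms-vanish : ∑ C (λ c → ∑ (allFin n) (λ x → [ not (inFirstRow x) ]· term (τ (c x) N) c)) ≡ + 0
      lower-terms-vanish = begin
        ∑ C (λ c → ∑ (allFin n) (λ x → [ not (inFirstRow x) ]· term (τ (c x) N) c))
          ≡⟨ ∑-comm C (allFin n) (λ c x → [ not (inFirstRow x) ]· term (τ (c x) N) c) ⟩
        ∑ (allFin n) (λ x → ∑ C (λ c → [ not (inFirstRow x) ]· term (τ (c x) N) c))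
          ≡⟨ ∑-cong (allFin n) each ⟩
        ∑ (allFin n) (λ _ → + 0)
          ≡⟨ ∑-zero (allFin n) ⟩
        + 0 ∎
        where
        open ≡-Reasoning
        each : ∀ x → ∑ C (λ c → [ not (inFirstRow x) ]· term (τ (c x) N) c) ≡ + 0
        each x with inFirstRow x in x-first
        ... | true  = ∑-zero C
        ... | false = lower-vanishes x x-first

    Jn-polytabloid : Jn (polytabloid {sh} t) ≈M ((+ k) ·M polytabloid {sh} t)
    Jn-polytabloid X = begin
      coeff (Jn e) X
        ≡⟨ coeff-Jn X e N t-last ⟩
      ∑ (allFin n) (λ a → [ a <ᵇ N ]· coeff (actM (τ a N) e) X)
        ≡⟨ ∑-cong (allFin n) (λ a → trans (cong [ a <ᵇ N ]·_ (coeff-actM-polytabloid {sh} t X (τ a N))) ([·]-∑ (a <ᵇ N) C _)) ⟩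
      ∑ (allFin n) (λ a → ∑ C (λ c → [ a <ᵇ N ]· term X (τ a N) c))
        ≡⟨ ∑-comm (allFin n) C (λ a c → [ a <ᵇ N ]· term X (τ a N) c) ⟩
      ∑ C (λ c → ∑ (allFin n) (λ a → [ a <ᵇ N ]· term X (τ a N) c))
        ≡⟨ ∑-cong-∈ C (λ c → row-split X) ⟩
      ∑ C (λ c → + k * term X id c + lower c)
        ≡⟨ ∑-+ C (λ c → + k * term X id c) lower ⟩
      ∑ C (λ c → + k * term X id c) + ∑ C lower
        ≡⟨ cong₂ _+_ (∑-*ˡ C (+ k) (term X id)) (lower-terms-vanish X) ⟩
      + k * ∑ C (term X id) + + 0
        ≡⟨ +-identityʳ _ ⟩
      + k * ∑ C (term X id)
        ≡⟨ cong (+ k *_) (coeff-polytabloid {sh} t X) ⟨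
      + k * coeff e X
        ≡⟨ coeff-·M X (+ k) e ⟨
      coeff ((+ k) ·M e) X ∎
      where
      open ≡-Reasoning
      e : FormalSum n (suc (List.length rows))
      e = polytabloid {sh} t
      lower : (Fin n → Fin n) → ℤ
      lower c = ∑ (allFin n) (λ x → [ not (inFirstRow x) ]· term X (τ (c x) N) c)

  1+k+m-m-1≡k : ∀ {k m n} → suc k ℕ.+ m ≡ n → (+ n ℤ.- + m) ℤ.- + 1 ≡ + k
  1+k+m-m-1≡k {k} {m} refl = cancel (+ k) (+ m)
    where
    cancel : ∀ a b → (+ 1 + a + b ℤ.- b) ℤ.- + 1 ≡ a
    cancel = solve-∀

open Eigenvector using (Jn-polytabloid; 1+k+m-m-1≡k)
open import Data.Nat using (_≤_; _<_; _+_)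
open import Data.Nat.ListAction using (sum)
open import Data.Integer using (+_; _-_)
open import Data.List.Relation.Unary.Linked.Properties using (Linked⇒All)
import Data.List.Relation.Unary.Linked as Linked

proposition3 : (n l₁ l₂ : ℕ) (rest : List ℕ) → 3 ≤ n →
    IsPartition n (l₁ ∷ l₂ ∷ rest) → l₂ < l₁ →
    (t : Cell (l₁ ∷ l₂ ∷ rest) → Fin n) → IsStandard t → nInLastCellOfFirstRow t →
    Jn (polytabloid t) ≈M (((+ n - + (l₂ + sum rest)) - + 1) ·M polytabloid t)
proposition3 n (suc k) l₂ rest _ λ-partition l₂<l₁ t t-standard n-last X =
  trans (Jn-polytabloid t (IsStandard.tableau t-standard) lower-rows≤k n-at-end X)
        (cong (λ a → coeff (a ·M polytabloid t) X) (sym (1+k+m-m-1≡k {k} {l₂ + sum rest} (IsPartition.sums λ-partition))))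
  where
  lower-rows≤k : All.All (_≤ k) (l₂ ∷ rest)
  lower-rows≤k = Linked⇒All (λ a≥b b≥c → ℕₚ.≤-trans b≥c a≥b) (ℕₚ.≤-pred l₂<l₁)
                            (Linked.tail (IsPartition.decr λ-partition))
  n-at-end : toℕ (t (0F , Fin.fromℕ k)) ≡ n ∸ 1
  n-at-end = n-last (0F , Fin.fromℕ k) refl (cong suc (Finₚ.toℕ-fromℕ k))
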